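{- Let $a,b,x$ be non-commuting indeterminates and define noncommutative polynomials $d_n(a,b,x)$, $n\ge 1$, by $$d_1=1,\qquad d_n=d_{n-1}\,x+\sum_{k=2}^{n-1} d_{n-k}\,a\,d_k\,b\quad (n\ge 2).$$ Then for every $n\ge1$, the number of monomials (words in $a,b,x$) occurring in $d_n(a,b,x)$ is the Catalan number $C_{n-1}=\frac{1}{n}\binom{2n-2}{n-1}$. -}

module Defs where

open import Data.Nat using (ℕ; zero; suc)
open import Data.List using (List; []; _∷_; _++_; map; concatMap; zip; drop; reverse; foldr; length; deduplicate)
open import Data.List.Properties using (≡-dec)
open import Data.Product using (_×_; _,_)
open import Relation.Binary.PropositionalEquality using (_≡_; refl)
open import Relation.Nullary using (yes; no)

data Letter : Set where
  a b x : Letter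

_≟L_ : (u v : Letter) → Relation.Nullary.Dec (u ≡ v)
a ≟L a = yes refl
a ≟L b = no λ ()
a ≟L x = no λ ()
b ≟L a = no λ ()
b ≟L b = yes refl
b ≟L x = no λ ()
x ≟L a = no λ ()
x ≟L b = no λ ()
x ≟L x = yes refl

Word : Set
Word = List Letter

_≟W_ : (u v : Word) → Relation.Nullary.Dec (u ≡ v)
_≟W_ = ≡-dec _≟L_

-- A noncommutative polynomial with coefficients in ℕ, represented as a formal
-- sum of words (a multiset of words, listed with multiplicity).
Poly : Set
Poly = List Word

one : Poly
one = [] ∷ []

zeroP : Poly
zeroP = []

var : Letter → Poly
var l = (l ∷ []) ∷ []

_⊕_ : Poly → Poly → Poly
p ⊕ q = p ++ q

_⊗_ : Poly → Poly → Poly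
p ⊗ q = concatMap (λ u → map (u ++_) q) p

infixl 7 _⊗_
infixl 6 _⊕_

-- Given [d_n, d_{n-1}, ..., d_1] compute d_{n+1}:
--   d_1 = 1,   d_{n+1} = d_n x + Σ_{k=2}^{n} d_{n+1-k} a d_k b.
next : List Poly → Poly
next [] = one
next L@(dn ∷ rest) =
  dn ⊗ var x ⊕
  foldr (λ { (p , q) acc → p ⊗ var a ⊗ q ⊗ var b ⊕ acc }) zeroP
        (zip rest (drop 1 (reverse L)))

-- dsRev n = [d_n, ..., d_1]
dsRev : ℕ → List Poly
dsRev zero = []
dsRev (suc n) = next (dsRev n) ∷ dsRev n

-- d n = d_n for n ≥ 1 (d 0 is the zero polynomial, never used).
d : ℕ → Poly
d zero = zeroP
d (suc n) = next (dsRev n)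

-- Number of distinct monomials occurring in a polynomial
-- (coefficients are natural numbers, so no cancellation occurs).
numMonomials : Poly → ℕ
numMonomials p = length (deduplicate _≟W_ p)

module Submission where

-- Arithmetic: any sequence with c 0 = 1 and c (m+1) = Σ_{i+j=m} c i * c j
-- satisfies (m+1) * c m = binom(2m, m).  Writing C(x) for its generating
-- function, C = 1 + x C², so the convolution powers C^r obey
-- C^{r+1} = C^r + x C^{r+2}; by a double induction this identifies the
-- coefficients of C^r with ballot numbers binom(r+2k+1,k+1) - binom(r+2k+1,k),
-- and r = 1 together with binom(n,k+1)(k+1) = binom(n,k)(n-k) gives the claim.
--
-- Combinatorics: reading a as an opening and b as a closing bracket, every
-- monomial of d_{n+1} is a balanced word of degree n in a and x, and a word
-- has at most one factorisation u a v b with v balanced.  Hence the terms of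
-- the recursion contribute pairwise distinct monomials, d_{n+1} has no
-- repeated monomial, and the number of monomials c n = length d_{n+1}
-- satisfies the Catalan recurrence.

open import Defs
open import Function using (_∘_)
open import Data.Empty using (⊥-elim)
open import Data.Product using (_×_; _,_; proj₁; proj₂; ∃-syntax; ∃₂)
open import Data.Sum using (inj₁; inj₂)
open import Data.Nat using (ℕ; zero; suc; _+_; _*_; _∸_; _/_; _≤_; _<_; s≤s)
open import Data.Nat.Properties
open import Data.Nat.DivMod using (m*n/n≡m)
open import Data.Nat.Combinatorics using (_C_; nCk+nC[k+1]≡[n+1]C[k+1]; nCk≡nC[n∸k])
open import Data.Nat.Induction using (<-rec)
open import Data.Nat.Tactic.RingSolver using (solve-∀)
open import Data.List using (List; []; _∷_; _++_; _∷ʳ_; map; zip; drop; reverse; foldr; length; filter; deduplicate; cartesianProductWith)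
open import Data.List.Properties using (∷-injective; ++-assoc; ∷ʳ-injective; ∷ʳ-injectiveˡ; ++-cancelˡ; length-++; length-map; unfold-reverse; filter-all)
open import Data.List.Membership.Propositional using (_∈_)
open import Data.List.Membership.Propositional.Properties using (∈-map⁻; ∈-++⁻; ∈-cartesianProductWith⁻)
open import Data.List.Relation.Unary.Any using (here; there)
open import Data.List.Relation.Unary.All using ([]) renaming (lookup to lookupAll)
open import Data.List.Relation.Unary.AllPairs using ([]; _∷_)
open import Data.List.Relation.Unary.Unique.Propositional using (Unique)
import Data.List.Relation.Unary.Unique.Propositional.Properties as Unique
open import Relation.Nullary using (¬_; ¬?)
open import Relation.Binary.PropositionalEquality
open ≡-Reasoning

conv : (ℕ → ℕ) → (ℕ → ℕ) → ℕ → ℕ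
conv f g zero = f 0 * g 0
conv f g (suc m) = f 0 * g (suc m) + conv (f ∘ suc) g m

conv-cong : ∀ {f f' g g'} → (∀ i → f i ≡ f' i) → (∀ i → g i ≡ g' i) →
            ∀ m → conv f g m ≡ conv f' g' m
conv-cong f≗f' g≗g' zero = cong₂ _*_ (f≗f' 0) (g≗g' 0)
conv-cong f≗f' g≗g' (suc m) =
  cong₂ _+_ (cong₂ _*_ (f≗f' 0) (g≗g' (suc m))) (conv-cong (f≗f' ∘ suc) g≗g' m)

-- Linearity in the first argument; it is what associativity reduces to.
conv-linearˡ : ∀ α p q r m →
               conv (λ k → α * p k + q k) r m ≡ α * conv p r m + conv q r m
conv-linearˡ α p q r zero = distrib α (p 0) (q 0) (r 0)
  where
  distrib : ∀ α p q r → (α * p + q) * r ≡ α * (p * r) + q * r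
  distrib = solve-∀
conv-linearˡ α p q r (suc m) = begin
  (α * p 0 + q 0) * r (suc m) + conv (λ k → α * p (suc k) + q (suc k)) r m
    ≡⟨ cong ((α * p 0 + q 0) * r (suc m) +_) (conv-linearˡ α (p ∘ suc) (q ∘ suc) r m) ⟩
  (α * p 0 + q 0) * r (suc m) + (α * conv (p ∘ suc) r m + conv (q ∘ suc) r m)
    ≡⟨ regroup α (p 0) (q 0) (r (suc m)) _ _ ⟩
  α * (p 0 * r (suc m) + conv (p ∘ suc) r m) + (q 0 * r (suc m) + conv (q ∘ suc) r m) ∎
  where
  regroup : ∀ α p q r X Y → (α * p + q) * r + (α * X + Y) ≡ α * (p * r + X) + (q * r + Y)
  regroup = solve-∀

conv-assoc : ∀ f g h m → conv (conv f g) h m ≡ conv f (conv g h) m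
conv-assoc f g h zero = *-assoc (f 0) (g 0) (h 0)
conv-assoc f g h (suc m) = begin
  f 0 * g 0 * h (suc m) + conv (λ i → f 0 * g (suc i) + conv (f ∘ suc) g i) h m
    ≡⟨ cong (f 0 * g 0 * h (suc m) +_) (conv-linearˡ (f 0) (g ∘ suc) (conv (f ∘ suc) g) h m) ⟩
  f 0 * g 0 * h (suc m) + (f 0 * conv (g ∘ suc) h m + conv (conv (f ∘ suc) g) h m)
    ≡⟨ cong (λ z → f 0 * g 0 * h (suc m) + (f 0 * conv (g ∘ suc) h m + z)) (conv-assoc (f ∘ suc) g h m) ⟩
  f 0 * g 0 * h (suc m) + (f 0 * conv (g ∘ suc) h m + conv (f ∘ suc) (conv g h) m)
    ≡⟨ regroup (f 0) (g 0) (h (suc m)) _ _ ⟩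
  f 0 * (g 0 * h (suc m) + conv (g ∘ suc) h m) + conv (f ∘ suc) (conv g h) m ∎
  where
  regroup : ∀ a b c X Y → a * b * c + (a * X + Y) ≡ a * (b * c + X) + Y
  regroup = solve-∀

δ : ℕ → ℕ
δ zero = 1
δ (suc _) = 0

conv-identityʳ : ∀ f m → conv f δ m ≡ f m
conv-identityʳ f zero = *-identityʳ (f 0)
conv-identityʳ f (suc m) = cong₂ _+_ (*-zeroʳ (f 0)) (conv-identityʳ (f ∘ suc) m)

-- Pascal's triangle, so that Pascal's rule holds by definition.
binom : ℕ → ℕ → ℕ
binom n zero = 1
binom zero (suc k) = 0
binom (suc n) (suc k) = binom n k + binom n (suc k)

binom≡C : ∀ n k → binom n k ≡ n C k
binom≡C zero zero = refl
binom≡C (suc n) zero = refl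
binom≡C zero (suc k) = refl
binom≡C (suc n) (suc k) =
  trans (cong₂ _+_ (binom≡C n k) (binom≡C n (suc k))) (nCk+nC[k+1]≡[n+1]C[k+1] n k)

binom-sym : ∀ k j → binom (k + j) k ≡ binom (k + j) j
binom-sym k j = begin
  binom (k + j) k         ≡⟨ binom≡C (k + j) k ⟩
  (k + j) C k             ≡⟨ nCk≡nC[n∸k] (m≤m+n k j) ⟩
  (k + j) C (k + j ∸ k)   ≡⟨ cong ((k + j) C_) (m+n∸m≡n k j) ⟩
  (k + j) C j             ≡⟨ binom≡C (k + j) j ⟨
  binom (k + j) j         ∎

binom-one : ∀ n → binom n 1 ≡ n
binom-one zero = refl
binom-one (suc n) = cong suc (binom-one n)

binom-absorb : ∀ n k → suc k * binom (suc n) (suc k) ≡ suc n * binom n k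
binom-absorb zero zero = refl
binom-absorb zero (suc k) = *-zeroʳ (suc (suc k))
binom-absorb (suc n) zero = begin
  1 * binom (suc (suc n)) 1 ≡⟨ *-identityˡ _ ⟩
  binom (suc (suc n)) 1     ≡⟨ binom-one (suc (suc n)) ⟩
  suc (suc n)               ≡⟨ *-identityʳ _ ⟨
  suc (suc n) * 1           ∎
binom-absorb (suc n) (suc k) = begin
  suc (suc k) * (B (suc k) + B (suc (suc k)))
    ≡⟨ regroup (suc k) (B (suc k)) (B (suc (suc k))) ⟩
  B (suc k) + (suc k * B (suc k) + suc (suc k) * B (suc (suc k)))
    ≡⟨ cong (B (suc k) +_) (cong₂ _+_ (binom-absorb n k) (binom-absorb n (suc k))) ⟩
  B (suc k) + (suc n * binom n k + suc n * binom n (suc k))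
    ≡⟨ cong (B (suc k) +_) (*-distribˡ-+ (suc n) (binom n k) (binom n (suc k))) ⟨
  suc (suc n) * B (suc k) ∎
  where
  B = binom (suc n)
  regroup : ∀ k p q → suc k * (p + q) ≡ p + (k * p + suc k * q)
  regroup = solve-∀

binom-ratio : ∀ k j → suc k * binom (k + j) (suc k) ≡ j * binom (k + j) k
binom-ratio k j = +-cancelˡ-≡ (suc k * P) _ _ (begin
  suc k * P + suc k * Q   ≡⟨ *-distribˡ-+ (suc k) P Q ⟨
  suc k * (P + Q)         ≡⟨ binom-absorb (k + j) k ⟩
  (suc k + j) * P         ≡⟨ *-distribʳ-+ P (suc k) j ⟩
  suc k * P + j * P       ∎)
  where
  P = binom (k + j) k
  Q = binom (k + j) (suc k)

scaled-difference : ∀ k c P Q → c + P ≡ Q → suc k * Q ≡ suc (suc k) * P →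
                    suc (suc k) * c ≡ Q
scaled-difference k c P Q c+P≡Q ratio = +-cancelʳ-≡ _ _ _ (begin
  suc (suc k) * c + suc (suc k) * P  ≡⟨ *-distribˡ-+ (suc (suc k)) c P ⟨
  suc (suc k) * (c + P)              ≡⟨ cong (suc (suc k) *_) c+P≡Q ⟩
  Q + suc k * Q                      ≡⟨ cong (Q +_) ratio ⟩
  Q + suc (suc k) * P                ∎)

module CatalanRecurrence (c : ℕ → ℕ) (c-zero : c 0 ≡ 1)
                         (c-suc : ∀ m → c (suc m) ≡ conv c c m) where

  power : ℕ → ℕ → ℕ
  power zero = δ
  power (suc r) = conv c (power r)

  power-at-zero : ∀ r → power r 0 ≡ 1
  power-at-zero zero = refl
  power-at-zero (suc r) = cong₂ _*_ c-zero (power-at-zero r)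

  -- C = 1 + x C² gives C^{r+1} = C^r + x C^{r+2}.
  power-step : ∀ r k → power (suc r) (suc k) ≡ power r (suc k) + power (suc (suc r)) k
  power-step r k = cong₂ _+_
    (trans (cong (_* power r (suc k)) c-zero) (*-identityˡ _))
    (trans (conv-cong c-suc (λ _ → refl) k) (conv-assoc c c (power r) k))

  -- The rows of the ballot formula used for (r + 2, k) and (r, k + 1) coincide.
  ballot-top : ∀ r k → 2 + r + suc (k + k) ≡ r + suc (suc k + suc k)
  ballot-top = solve-∀

  ballot : ∀ r k → power r (suc k) + binom (r + suc (k + k)) k ≡ binom (r + suc (k + k)) (suc k)
  -- For r = 0 both sides are equal by the symmetry of the row 2k + 1.
  ballot zero k =
    subst (λ N → binom N k ≡ binom N (suc k)) (+-suc k k) (binom-sym k (suc k))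
  ballot (suc r) zero = begin
    power (suc r) 1 + 1          ≡⟨ cong (_+ 1) (power-step r 0) ⟩
    power r 1 + power (2 + r) 0 + 1 ≡⟨ cong (λ z → power r 1 + z + 1) (power-at-zero (2 + r)) ⟩
    power r 1 + 1 + 1            ≡⟨ cong (_+ 1) (ballot r 0) ⟩
    binom (r + 1) 1 + 1          ≡⟨ +-comm (binom (r + 1) 1) 1 ⟩
    1 + binom (r + 1) 1          ∎
  ballot (suc r) (suc k) = begin
    power (suc r) (suc (suc k)) + (binom M k + binom M (suc k))
      ≡⟨ cong (_+ (binom M k + binom M (suc k))) (power-step r (suc k)) ⟩
    (power r (suc (suc k)) + power (2 + r) (suc k)) + (binom M k + binom M (suc k))
      ≡⟨ regroup (power r (suc (suc k))) (power (2 + r) (suc k)) (binom M k) (binom M (suc k)) ⟩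
    (power r (suc (suc k)) + binom M (suc k)) + (power (2 + r) (suc k) + binom M k)
      ≡⟨ cong₂ _+_ (ballot r (suc k)) shifted ⟩
    binom M (suc (suc k)) + binom M (suc k)
      ≡⟨ +-comm (binom M (suc (suc k))) (binom M (suc k)) ⟩
    binom M (suc k) + binom M (suc (suc k)) ∎
    where
    M = r + suc (suc k + suc k)
    shifted : power (2 + r) (suc k) + binom M k ≡ binom M (suc k)
    shifted = subst (λ n → power (2 + r) (suc k) + binom n k ≡ binom n (suc k)) (ballot-top r k) (ballot (2 + r) k)
    regroup : ∀ p q x y → (p + q) + (x + y) ≡ (p + y) + (q + x)
    regroup = solve-∀

  -- (m+1) c_m = binom(2m, m): the case r = 1 of the ballot formula.
  catalan : ∀ m → suc m * c m ≡ binom (m + m) m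
  catalan zero = trans (*-identityˡ (c 0)) c-zero
  catalan (suc k) = subst (λ n → suc (suc k) * c (suc k) ≡ binom n (suc k)) (sym (+-suc (suc k) k))
    (scaled-difference k (c (suc k)) (binom N k) (binom N (suc k)) difference ratio)
    where
    N = suc (suc (k + k))
    difference : c (suc k) + binom N k ≡ binom N (suc k)
    difference = trans (cong (_+ binom N k) (sym (conv-identityʳ c (suc k)))) (ballot 1 k)
    ratio : suc k * binom N (suc k) ≡ suc (suc k) * binom N k
    ratio = subst (λ n → suc k * binom n (suc k) ≡ suc (suc k) * binom n k)
                  (trans (+-suc k (suc k)) (cong suc (+-suc k k))) (binom-ratio k (suc (suc k)))

  closed-form : ∀ m → c m ≡ ((2 * m) C m) / suc m
  closed-form m = begin
    c m                            ≡⟨ m*n/n≡m (c m) (suc m) ⟨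
    (c m * suc m) / suc m          ≡⟨ cong (_/ suc m) (trans (*-comm (c m) (suc m)) (catalan m)) ⟩
    binom (m + m) m / suc m        ≡⟨ cong (_/ suc m) (binom≡C (m + m) m) ⟩
    ((m + m) C m) / suc m          ≡⟨ cong (λ n → (n C m) / suc m) (cong (m +_) (+-identityʳ m)) ⟨
    ((2 * m) C m) / suc m          ∎

-- Reading a as an opening and b as a closing bracket (x is neutral),
-- Closes n w says that w closes exactly n brackets opened before it while
-- every bracket opened inside w is also closed inside w.
data Closes : ℕ → Word → Set where
  empty   : Closes 0 []
  open-a  : ∀ {n w} → Closes (suc n) w → Closes n (a ∷ w)
  close-b : ∀ {n w} → Closes n w → Closes (suc n) (b ∷ w)
  skip-x  : ∀ {n w} → Closes n w → Closes n (x ∷ w)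

Balanced : Word → Set
Balanced = Closes 0

closes-++ : ∀ {m n u v} → Closes m u → Closes n v → Closes (m + n) (u ++ v)
closes-++ empty        cv = cv
closes-++ (open-a cu)  cv = open-a (closes-++ cu cv)
closes-++ (close-b cu) cv = close-b (closes-++ cu cv)
closes-++ (skip-x cu)  cv = skip-x (closes-++ cu cv)

closes-suffix : ∀ {n} u {v} → Closes n (u ++ v) → ∃[ m ] Closes m v
closes-suffix []      cv          = _ , cv
closes-suffix (_ ∷ u) (open-a c)  = closes-suffix u c
closes-suffix (_ ∷ u) (close-b c) = closes-suffix u c
closes-suffix (_ ∷ u) (skip-x c)  = closes-suffix u c

closes-depth : ∀ {m n w} → Closes m w → Closes n w → m ≡ n
closes-depth empty       empty        = refl
closes-depth (open-a c)  (open-a c')  = suc-injective (closes-depth c c')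
closes-depth (close-b c) (close-b c') = cong suc (closes-depth c c')
closes-depth (skip-x c)  (skip-x c')  = closes-depth c c'

unclosed-a : ∀ {n} u {v} → Balanced v → ¬ Closes n (u ++ a ∷ v)
unclosed-a u bv c with closes-suffix u c
... | _ , open-a c' with closes-depth c' bv
... | ()

a-factorisation-unique : ∀ u u' {v v'} → Balanced v → Balanced v' →
                         u ++ a ∷ v ≡ u' ++ a ∷ v' → u ≡ u' × v ≡ v'
a-factorisation-unique []      []        bv bv' refl = refl , refl
a-factorisation-unique []      (_ ∷ u')  bv bv' refl = ⊥-elim (unclosed-a u' bv' bv)
a-factorisation-unique (_ ∷ u) []        bv bv' refl = ⊥-elim (unclosed-a u bv bv')
a-factorisation-unique (_ ∷ u) (_ ∷ u')  bv bv' eq with ∷-injective eq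
... | refl , eq' with a-factorisation-unique u u' bv bv' eq'
... | refl , refl = refl , refl

bracketed : Word → Word → Word
bracketed u v = u ++ a ∷ (v ++ b ∷ [])

bracketed-assoc : ∀ u v → bracketed u v ≡ (u ++ a ∷ v) ∷ʳ b
bracketed-assoc u v = sym (++-assoc u (a ∷ v) (b ∷ []))

bracketed-injective : ∀ u u' {v v'} → Balanced v → Balanced v' →
                      bracketed u v ≡ bracketed u' v' → u ≡ u' × v ≡ v'
bracketed-injective u u' {v} {v'} bv bv' eq = a-factorisation-unique u u' bv bv'
  (∷ʳ-injectiveˡ (u ++ a ∷ v) (u' ++ a ∷ v')
    (trans (sym (bracketed-assoc u v)) (trans eq (bracketed-assoc u' v'))))

bracketed-balanced : ∀ {u v} → Balanced u → Balanced v → Balanced (bracketed u v)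
bracketed-balanced bu bv = closes-++ bu (open-a (closes-++ bv (close-b empty)))

-- The degree in a and x; every monomial of d_{n+1} has degree n.
degree : Word → ℕ
degree []      = 0
degree (a ∷ w) = suc (degree w)
degree (b ∷ w) = degree w
degree (x ∷ w) = suc (degree w)

degree-++ : ∀ u v → degree (u ++ v) ≡ degree u + degree v
degree-++ []      v = refl
degree-++ (a ∷ u) v = cong suc (degree-++ u v)
degree-++ (b ∷ u) v = degree-++ u v
degree-++ (x ∷ u) v = cong suc (degree-++ u v)

degree-bracketed : ∀ u v → degree (bracketed u v) ≡ degree u + suc (degree v)
degree-bracketed u v = trans (degree-++ u (a ∷ (v ++ b ∷ [])))
  (cong (λ n → degree u + suc n) (trans (degree-++ v (b ∷ [])) (+-identityʳ (degree v))))

⊗-cartesian : ∀ p q → p ⊗ q ≡ cartesianProductWith _++_ p q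
⊗-cartesian []      q = refl
⊗-cartesian (u ∷ p) q = cong (map (u ++_) q ++_) (⊗-cartesian p q)

∈-⊗⁻ : ∀ p q {w} → w ∈ p ⊗ q → ∃₂ λ u v → u ∈ p × v ∈ q × w ≡ u ++ v
∈-⊗⁻ p q w∈ = ∈-cartesianProductWith⁻ _++_ p q (subst (_ ∈_) (⊗-cartesian p q) w∈)

length-⊗ : ∀ p q → length (p ⊗ q) ≡ length p * length q
length-⊗ []      q = refl
length-⊗ (u ∷ p) q =
  trans (length-++ (map (u ++_) q)) (cong₂ _+_ (length-map (u ++_) q) (length-⊗ p q))

unique-⊗ : ∀ p q → Unique p → Unique q →
           (∀ {u u' v v'} → u ∈ p → u' ∈ p → v ∈ q → v' ∈ q → u ++ v ≡ u' ++ v' → u ≡ u') →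
           Unique (p ⊗ q)
unique-⊗ []      q up         uq prefix = []
unique-⊗ (u ∷ p) q (u∉p ∷ up) uq prefix =
  Unique.++⁺ (Unique.map⁺ (λ {v} {v'} → ++-cancelˡ u v v') uq)
             (unique-⊗ p q up uq (λ u∈ u'∈ → prefix (there u∈) (there u'∈)))
             disjoint
  where
  disjoint : ∀ {w} → ¬ (w ∈ map (u ++_) q × w ∈ p ⊗ q)
  disjoint (w∈₁ , w∈₂) with ∈-map⁻ (u ++_) w∈₁ | ∈-⊗⁻ p q w∈₂
  ... | v , v∈ , eq | u' , v' , u'∈ , v'∈ , eq' =
    lookupAll u∉p u'∈ (prefix (here refl) (there u'∈) v∈ v'∈ (trans (sym eq) eq'))

∈-var : ∀ {l v} → v ∈ var l → v ≡ l ∷ []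
∈-var (here eq) = eq

∈-⊗var : ∀ p l {w} → w ∈ p ⊗ var l → ∃[ u ] u ∈ p × w ≡ u ∷ʳ l
∈-⊗var p l w∈ with ∈-⊗⁻ p (var l) w∈
... | u , v , u∈ , v∈ , eq = u , u∈ , trans eq (cong (u ++_) (∈-var v∈))

unique-⊗var : ∀ p l → Unique p → Unique (p ⊗ var l)
unique-⊗var p l up = unique-⊗ p (var l) up ([] ∷ []) λ {u} {u'} _ _ v∈ v'∈ eq →
  ∷ʳ-injectiveˡ u u' (trans (cong (u ++_) (sym (∈-var v∈))) (trans eq (cong (u' ++_) (∈-var v'∈))))

bracketTerm : Poly → Poly → Poly
bracketTerm p q = p ⊗ var a ⊗ q ⊗ var b

∈-bracketTerm⁻ : ∀ p q {w} → w ∈ bracketTerm p q → ∃₂ λ u v → u ∈ p × v ∈ q × w ≡ bracketed u v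
∈-bracketTerm⁻ p q w∈ with ∈-⊗var (p ⊗ var a ⊗ q) b w∈
... | w₁ , w₁∈ , refl with ∈-⊗⁻ (p ⊗ var a) q w₁∈
... | w₂ , v , w₂∈ , v∈ , refl with ∈-⊗var p a w₂∈
... | u , u∈ , refl = u , v , u∈ , v∈ , (begin
  ((u ∷ʳ a) ++ v) ∷ʳ b   ≡⟨ cong (_∷ʳ b) (++-assoc u (a ∷ []) v) ⟩
  (u ++ a ∷ v) ∷ʳ b      ≡⟨ bracketed-assoc u v ⟨
  bracketed u v          ∎)

unique-bracketTerm : ∀ p q → Unique p → Unique q → (∀ {v} → v ∈ q → Balanced v) →
                     Unique (bracketTerm p q)
unique-bracketTerm p q up uq balanced =
  unique-⊗var (p ⊗ var a ⊗ q) b (unique-⊗ (p ⊗ var a) q (unique-⊗var p a up) uq prefix)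
  where
  prefix : ∀ {u u' v v'} → u ∈ p ⊗ var a → u' ∈ p ⊗ var a → v ∈ q → v' ∈ q →
           u ++ v ≡ u' ++ v' → u ≡ u'
  prefix {v = v} {v'} u∈ u'∈ v∈ v'∈ eq with ∈-⊗var p a u∈ | ∈-⊗var p a u'∈
  ... | r , _ , refl | r' , _ , refl = cong (_∷ʳ a) (proj₁ (a-factorisation-unique r r'
    (balanced v∈) (balanced v'∈) (trans (sym (++-assoc r (a ∷ []) v)) (trans eq (++-assoc r' (a ∷ []) v')))))

length-bracketTerm : ∀ p q → length (bracketTerm p q) ≡ length p * length q
length-bracketTerm p q = begin
  length (p ⊗ var a ⊗ q ⊗ var b)    ≡⟨ length-⊗ (p ⊗ var a ⊗ q) (var b) ⟩
  length (p ⊗ var a ⊗ q) * 1        ≡⟨ *-identityʳ _ ⟩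
  length (p ⊗ var a ⊗ q)            ≡⟨ length-⊗ (p ⊗ var a) q ⟩
  length (p ⊗ var a) * length q     ≡⟨ cong (_* length q) (trans (length-⊗ p (var a)) (*-identityʳ (length p))) ⟩
  length p * length q               ∎

ascending : ℕ → ℕ → List Poly
ascending s zero    = []
ascending s (suc n) = d s ∷ ascending (suc s) n

ascending-snoc : ∀ s n → ascending s (suc n) ≡ ascending s n ∷ʳ d (s + n)
ascending-snoc s zero    = cong (λ i → d i ∷ []) (sym (+-identityʳ s))
ascending-snoc s (suc n) = cong (d s ∷_) (trans (ascending-snoc (suc s) n)
  (cong (λ i → ascending (suc s) n ∷ʳ d i) (sym (+-suc s n))))

reverse-dsRev : ∀ n → reverse (dsRev n) ≡ ascending 1 n
reverse-dsRev zero    = refl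
reverse-dsRev (suc n) = begin
  reverse (d (suc n) ∷ dsRev n)  ≡⟨ unfold-reverse (d (suc n)) (dsRev n) ⟩
  reverse (dsRev n) ∷ʳ d (suc n) ≡⟨ cong (_∷ʳ d (suc n)) (reverse-dsRev n) ⟩
  ascending 1 n ∷ʳ d (suc n)     ≡⟨ ascending-snoc 1 n ⟨
  ascending 1 (suc n)            ∎

brackets : ℕ → ℕ → Poly
brackets zero    s = []
brackets (suc k) s = bracketTerm (d (suc k)) (d (suc s)) ++ brackets k (suc s)

-- The sum in the definition of next, over the pairs (d_{k-i}, d_{s+1+i}),
-- is brackets k s (F is the summand of next, given up to its unfolding).
fold-brackets : ∀ {F : Poly × Poly → Poly → Poly} → (∀ p q r → F (p , q) r ≡ bracketTerm p q ++ r) →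
                ∀ k s → foldr F [] (zip (dsRev k) (ascending (suc s) k)) ≡ brackets k s
fold-brackets hF zero    s = refl
fold-brackets hF (suc k) s =
  trans (hF (d (suc k)) (d (suc s)) _) (cong (bracketTerm (d (suc k)) (d (suc s)) ++_) (fold-brackets hF k (suc s)))

d-unfold : ∀ m → d (suc (suc m)) ≡ d (suc m) ⊗ var x ++ brackets m 1
d-unfold m = cong (d (suc m) ⊗ var x ++_) (sum-unfold (λ _ _ _ → refl))
  where
  sum-unfold : ∀ {F} → (∀ p q r → F (p , q) r ≡ bracketTerm p q ++ r) →
               foldr F [] (zip (dsRev m) (drop 1 (reverse (dsRev (suc m))))) ≡ brackets m 1
  sum-unfold {F} hF = begin
    foldr F [] (zip (dsRev m) (drop 1 (reverse (dsRev (suc m)))))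
      ≡⟨ cong (λ L → foldr F [] (zip (dsRev m) (drop 1 L))) (reverse-dsRev (suc m)) ⟩
    foldr F [] (zip (dsRev m) (ascending 2 m))
      ≡⟨ fold-brackets hF m 1 ⟩
    brackets m 1 ∎

record WellFormed (n : ℕ) : Set where
  field
    distinct : Unique (d (suc n))
    balanced : ∀ {w} → w ∈ d (suc n) → Balanced w
    homogeneous : ∀ {w} → w ∈ d (suc n) → degree w ≡ n
open WellFormed

Below : ℕ → Set
Below n = ∀ {j} → j < n → WellFormed j

below-shift : ∀ k s → Below (suc k + s) → Below (k + suc s)
below-shift k s wf {j} j< = wf (subst (j <_) (+-suc k s) j<)

record InBrackets (k s : ℕ) (w : Word) : Set where
  field
    left right     : Word
    factorisation  : w ≡ bracketed left right
    left-balanced  : Balanced left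
    right-balanced : Balanced right
    total-degree   : degree w ≡ k + s
    right-degree   : s ≤ degree right

brackets-shape : ∀ k s → Below (k + s) → ∀ {w} → w ∈ brackets k s → InBrackets k s w
brackets-shape (suc k) s wf w∈ with ∈-++⁻ (bracketTerm (d (suc k)) (d (suc s))) w∈
... | inj₁ w∈head with ∈-bracketTerm⁻ (d (suc k)) (d (suc s)) w∈head
... | u , v , u∈ , v∈ , refl = record
  { left = u ; right = v ; factorisation = refl
  ; left-balanced = balanced wfk u∈ ; right-balanced = balanced wfs v∈
  ; total-degree = trans (degree-bracketed u v)
      (trans (cong₂ (λ i j → i + suc j) (homogeneous wfk u∈) (homogeneous wfs v∈)) (+-suc k s))
  ; right-degree = ≤-reflexive (sym (homogeneous wfs v∈)) }
  where
  wfk = wf (s≤s (m≤m+n k s))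
  wfs = wf (s≤s (m≤n+m s k))
brackets-shape (suc k) s wf w∈ | inj₂ w∈rest = record
  { left = left ; right = right ; factorisation = factorisation
  ; left-balanced = left-balanced ; right-balanced = right-balanced
  ; total-degree = trans total-degree (+-suc k s)
  ; right-degree = ≤-trans (n≤1+n s) right-degree }
  where open InBrackets (brackets-shape k (suc s) (below-shift k s wf) w∈rest)

brackets-distinct : ∀ k s → Below (k + s) → Unique (brackets k s)
brackets-distinct zero    s wf = []
brackets-distinct (suc k) s wf = Unique.++⁺
  (unique-bracketTerm (d (suc k)) (d (suc s)) (distinct wfk) (distinct wfs) (balanced wfs))
  (brackets-distinct k (suc s) (below-shift k s wf))
  disjoint
  where
  wfk = wf (s≤s (m≤m+n k s))
  wfs = wf (s≤s (m≤n+m s k))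
  -- The right factor of a head monomial has degree s, of a later one > s.
  disjoint : ∀ {w} → ¬ (w ∈ bracketTerm (d (suc k)) (d (suc s)) × w ∈ brackets k (suc s))
  disjoint (w∈head , w∈rest) with ∈-bracketTerm⁻ (d (suc k)) (d (suc s)) w∈head
  ... | u , v , _ , v∈ , refl with brackets-shape k (suc s) (below-shift k s wf) w∈rest
  ... | record { factorisation = eq ; right-balanced = bv' ; right-degree = s<deg }
    with bracketed-injective u _ (balanced wfs v∈) bv' eq
  ... | _ , refl = <-irrefl (sym (homogeneous wfs v∈)) s<deg

wellFormed-step : ∀ m → Below (suc m) → WellFormed (suc m)
wellFormed-step m wf = record
  { distinct = subst Unique (sym (d-unfold m))
      (Unique.++⁺ (unique-⊗var (d (suc m)) x (distinct wfm)) (brackets-distinct m 1 wf') disjoint)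
  ; balanced = λ w∈ → proj₁ (shape (subst (_ ∈_) (d-unfold m) w∈))
  ; homogeneous = λ w∈ → proj₂ (shape (subst (_ ∈_) (d-unfold m) w∈)) }
  where
  wfm = wf ≤-refl
  wf' : Below (m + 1)
  wf' = subst Below (+-comm 1 m) wf
  -- Monomials ending in x are not of the form u a v b.
  disjoint : ∀ {w} → ¬ (w ∈ d (suc m) ⊗ var x × w ∈ brackets m 1)
  disjoint (w∈₁ , w∈₂) with ∈-⊗var (d (suc m)) x w∈₁ | brackets-shape m 1 wf' w∈₂
  ... | u , _ , refl | record { left = u' ; right = v' ; factorisation = eq }
    with proj₂ (∷ʳ-injective u (u' ++ a ∷ v') (trans eq (bracketed-assoc u' v')))
  ... | ()
  shape : ∀ {w} → w ∈ d (suc m) ⊗ var x ++ brackets m 1 → Balanced w × degree w ≡ suc m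
  shape w∈ with ∈-++⁻ (d (suc m) ⊗ var x) w∈
  ... | inj₁ w∈₁ with ∈-⊗var (d (suc m)) x w∈₁
  ... | u , u∈ , refl = closes-++ (balanced wfm u∈) (skip-x empty)
                      , trans (degree-++ u (x ∷ [])) (trans (cong (_+ 1) (homogeneous wfm u∈)) (+-comm m 1))
  shape w∈ | inj₂ w∈₂ with brackets-shape m 1 wf' w∈₂
  ... | record { factorisation = refl ; left-balanced = bu ; right-balanced = bv ; total-degree = deg } =
    bracketed-balanced bu bv , trans deg (+-comm m 1)

wellFormed : ∀ n → WellFormed n
wellFormed = <-rec WellFormed step
  where
  step : ∀ n → Below n → WellFormed n
  step zero    _  = record
    { distinct = [] ∷ []
    ; balanced = λ { (here refl) → empty }
    ; homogeneous = λ { (here refl) → refl } }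
  step (suc m) wf = wellFormed-step m wf

count : ℕ → ℕ
count m = length (d (suc m))

length-brackets : ∀ k s → length (brackets (suc k) s) ≡ conv (λ i → count (s + i)) count k
length-brackets zero s = begin
  length (bracketTerm (d 1) (d (suc s)) ++ [])  ≡⟨ length-++ (bracketTerm (d 1) (d (suc s))) ⟩
  length (bracketTerm (d 1) (d (suc s))) + 0    ≡⟨ +-identityʳ _ ⟩
  length (bracketTerm (d 1) (d (suc s)))        ≡⟨ length-bracketTerm (d 1) (d (suc s)) ⟩
  count 0 * count s                             ≡⟨ *-comm (count 0) (count s) ⟩
  count s * count 0                             ≡⟨ cong (λ i → count i * count 0) (+-identityʳ s) ⟨
  count (s + 0) * count 0                       ∎
length-brackets (suc k) s = begin
  length (bracketTerm (d (suc (suc k))) (d (suc s)) ++ brackets (suc k) (suc s))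
    ≡⟨ length-++ (bracketTerm (d (suc (suc k))) (d (suc s))) ⟩
  length (bracketTerm (d (suc (suc k))) (d (suc s))) + length (brackets (suc k) (suc s))
    ≡⟨ cong₂ _+_ (length-bracketTerm (d (suc (suc k))) (d (suc s))) (length-brackets k (suc s)) ⟩
  count (suc k) * count s + conv (λ i → count (suc s + i)) count k
    ≡⟨ cong₂ _+_ (trans (*-comm (count (suc k)) (count s)) (cong (λ i → count i * count (suc k)) (sym (+-identityʳ s))))
                 (conv-cong (λ i → cong count (sym (+-suc s i))) (λ _ → refl) k) ⟩
  count (s + 0) * count (suc k) + conv (λ i → count (s + suc i)) count k ∎

count-suc : ∀ m → count (suc m) ≡ conv count count m
count-suc m = begin
  length (d (suc (suc m)))                         ≡⟨ cong length (d-unfold m) ⟩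
  length (d (suc m) ⊗ var x ++ brackets m 1)       ≡⟨ length-++ (d (suc m) ⊗ var x) ⟩
  length (d (suc m) ⊗ var x) + length (brackets m 1)
    ≡⟨ cong (_+ length (brackets m 1)) (trans (length-⊗ (d (suc m)) (var x)) (*-identityʳ (count m))) ⟩
  count m + length (brackets m 1)                  ≡⟨ split m ⟩
  conv count count m                               ∎
  where
  split : ∀ m → count m + length (brackets m 1) ≡ conv count count m
  split zero    = refl
  split (suc k) = cong₂ _+_ (sym (*-identityˡ (count (suc k)))) (length-brackets k 1)

deduplicate-unique : ∀ p → Unique p → deduplicate _≟W_ p ≡ p
deduplicate-unique []      _          = refl
deduplicate-unique (w ∷ p) (w∉p ∷ up) = cong (w ∷_)
  (trans (cong (filter (λ v → ¬? (w ≟W v))) (deduplicate-unique p up)) (filter-all (λ v → ¬? (w ≟W v)) w∉p))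

mainTheorem2 : ∀ (m : ℕ) → numMonomials (d (suc m)) ≡ ((2 * m) C m) / suc m
mainTheorem2 m = begin
  numMonomials (d (suc m))  ≡⟨ cong length (deduplicate-unique (d (suc m)) (distinct (wellFormed m))) ⟩
  count m                   ≡⟨ CatalanRecurrence.closed-form count refl count-suc m ⟩
  ((2 * m) C m) / suc m     ∎
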